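{- Let $f=(f_0,f_1,f_2,\dots)\in\{1,-1\}^{\mathbb{N}}$ be any folding instruction sequence, let $n\ge 7$, and let $k$ be the integer with $2^{k-1}<n\le 2^k$. Then $$A_f(n)=\begin{cases}4\cdot 2^k+n-1, & \text{if } f_{k+1}\ne f_{k+2},\\ 6\cdot 2^k+n-1, & \text{if } f_{k+1}=f_{k+2}.\end{cases}$$
   Context: A folding instruction sequence is an infinite sequence $f=(f_0,f_1,\dots)$ with each $f_i\in\{1,-1\}$ (indexed from $0$). The paper-folding sequence $P_f=P_f[1],P_f[2],\dots$ is defined by: for $m\ge1$ write $m=2^s r$ with $r$ odd; $P_f[m]=f_s$ if $r\equiv 1\pmod 4$ and $P_f[m]=-f_s$ if $r\equiv3\pmod4$. $P_f[i:j]$ denotes $P_f[i]\cdots P_f[j]$. A length-$n$ factor of $P_f$ is a word of the form $P_f[i:i+n-1]$, $i\ge1$. The appearance function $A_f(n)$ is the least integer $K$ such that every length-$n$ factor of $P_f$ occurs as a subword of the prefix $P_f[1:K]$. -}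

module Defs where

open import Data.Nat using (ℕ; zero; suc; _+_; _*_; _∸_; _^_; _≤_; _<_)
open import Data.Nat.DivMod using (_%_; _/_)
open import Data.Product using (Σ; _×_; _,_; ∃-syntax)
open import Data.List using (List; applyUpTo)
open import Relation.Binary.PropositionalEquality using (_≡_)

data Sign : Set where
  plus minus : Sign

neg : Sign → Sign
neg plus  = minus
neg minus = plus

FoldSeq : Set
FoldSeq = ℕ → Sign

-- decomposition m = 2^s * r with r odd (for m ≥ 1); returns (s , r).
-- The first argument is fuel (m itself suffices).
twoAdic : ℕ → ℕ → ℕ × ℕ
twoAdic zero     m = 0 , m
twoAdic (suc fu) zero = 0 , 0
twoAdic (suc fu) m@(suc _) with m % 2
... | zero  with twoAdic fu (m / 2)
...   | s , r = suc s , r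
twoAdic (suc fu) m@(suc _) | suc _ = 0 , m

val2 : ℕ → ℕ
val2 m = Data.Product.proj₁ (twoAdic m m)

oddPart : ℕ → ℕ
oddPart m = Data.Product.proj₂ (twoAdic m m)

P : FoldSeq → ℕ → Sign
P f m with oddPart m % 4
... | 1 = f (val2 m)
... | _ = neg (f (val2 m))

factor : FoldSeq → ℕ → ℕ → List Sign
factor f i n = applyUpTo (λ j → P f (i + j)) n

AllFactorsIn : FoldSeq → ℕ → ℕ → Set
AllFactorsIn f n K =
  (i : ℕ) → 1 ≤ i →
  ∃[ j ] (1 ≤ j × j + n ∸ 1 ≤ K × factor f j n ≡ factor f i n)

AppearanceIs : FoldSeq → ℕ → ℕ → Set
AppearanceIs f n K = AllFactorsIn f n K × ((K' : ℕ) → AllFactorsIn f n K' → K ≤ K')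

{-# OPTIONS --safe #-}
-- Write N = 2^k and M = 2^(k+1). Off the multiples of N the sequence P_f is
-- M-periodic, and a window of length n ≤ N meets at most one multiple t·N. The
-- letter at t·N is f_k or -f_k for odd t, and for even t it is f_(k+1) at M or
-- -f_(k+1) at c·M, where c (2 or 3, according as f_(k+2) differs from f_(k+1)
-- or not) is the least u ≥ 1 with P_f[u·M] ≠ f_(k+1). Hence every factor of
-- length n already occurs in P_f[1 : c·M + n - 1]. Conversely the factor starting
-- at c·M has no earlier occurrence j: odd j are ruled out by the letters at
-- offsets 2 and 6, j = 2^(t+1)·odd with t < k by the letter at offset 2^t, and
-- multiples j of M by the choice of c.
module Submission where

open import Defs
open import Data.Nat using (ℕ; suc; _+_; _*_; _∸_; _^_; _≤_; _<_)
open import Relation.Binary.PropositionalEquality using (_≡_; _≢_)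
open import Data.Product using (_×_)

open import Data.Nat
  using (zero; z≤n; s≤s; NonZero; >-nonZero; _≤?_)
open import Data.Nat.Properties
open import Data.Nat.DivMod
  using (_%_; _/_; m≡m%n+[m/n]*n; m*n%n≡0; m*n/n≡m; [m+kn]%n≡m%n; %-remove-+ʳ; %-remove-+ˡ; m%n≤n)
open import Data.Nat.Divisibility
open import Data.Nat.Induction using (<-rec)
open import Data.Nat.Tactic.RingSolver using (solve-∀)
open import Algebra.Properties.CommutativeSemigroup +-commutativeSemigroup using (xy∙z≈xz∙y)
open import Data.Product using (∃; ∃₂; ∃-syntax; _,_; proj₁; proj₂; map₁)
open import Data.Sum using (_⊎_; inj₁; inj₂)
open import Data.List using (applyUpTo; _∷_)
open import Data.List.Properties using (∷-injective)
open import Data.Empty using (⊥-elim)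
open import Function using (_∘_)
open import Relation.Nullary using (¬_; yes; no; contradiction)
open import Relation.Binary.PropositionalEquality
  using (refl; sym; trans; cong; cong₂; subst; subst₂; module ≡-Reasoning)

open ≡-Reasoning

neg-≢ : ∀ x → neg x ≢ x
neg-≢ plus  ()
neg-≢ minus ()

≢⇒≡neg : ∀ {x y} → x ≢ y → y ≡ neg x
≢⇒≡neg {plus}  {plus}  x≢y = contradiction refl x≢y
≢⇒≡neg {plus}  {minus} _   = refl
≢⇒≡neg {minus} {plus}  _   = refl
≢⇒≡neg {minus} {minus} x≢y = contradiction refl x≢y

≡⊎≡neg : ∀ x y → x ≡ y ⊎ x ≡ neg y
≡⊎≡neg plus  plus  = inj₁ refl
≡⊎≡neg plus  minus = inj₂ refl
≡⊎≡neg minus plus  = inj₂ refl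
≡⊎≡neg minus minus = inj₁ refl

n<2^n : ∀ n → n < 2 ^ n
n<2^n zero    = s≤s z≤n
n<2^n (suc n) = ≤-trans (+-mono-≤ (m^n>0 2 n) (n<2^n n))
                        (≤-reflexive (cong (2 ^ n +_) (sym (+-identityʳ (2 ^ n)))))

^-monoʳ-∣ : ∀ m {n o} → n ≤ o → m ^ n ∣ m ^ o
^-monoʳ-∣ m {n} n≤o with m≤n⇒∃[o]m+o≡n n≤o
... | w , refl = divides (m ^ w) (trans (^-distribˡ-+-* m n w) (*-comm (m ^ n) (m ^ w)))

∣∧<⇒≡0 : ∀ {m n} → m ∣ n → n < m → n ≡ 0
∣∧<⇒≡0 (divides zero    n≡0)  _   = n≡0
∣∧<⇒≡0 {m} (divides (suc q) refl) n<m = contradiction n<m (≤⇒≯ (m≤m+n m (q * m)))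

-- Evaluating P_f on 2^s · r with r odd

letter : ℕ → Sign → Sign
letter 1 x = x
letter _ x = neg x

P≡letter : ∀ f m → P f m ≡ letter (oddPart m % 4) (f (val2 m))
P≡letter f m with oddPart m % 4
... | 0           = refl
... | 1           = refl
... | suc (suc _) = refl

twoAdic-odd : ∀ fuel r → r % 2 ≡ 1 → twoAdic fuel r ≡ (0 , r)
twoAdic-odd zero       r       _     = refl
twoAdic-odd (suc fuel) zero    ()
twoAdic-odd (suc fuel) (suc r) r-odd rewrite r-odd = refl

twoAdic-even : ∀ fuel m → suc m % 2 ≡ 0 →
  twoAdic (suc fuel) (suc m) ≡ map₁ suc (twoAdic fuel (suc m / 2))
twoAdic-even fuel m m-even rewrite m-even with twoAdic fuel (suc m / 2)
... | s , r = refl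

twoAdic-double : ∀ fuel m .{{_ : NonZero m}} →
  twoAdic (suc fuel) (m * 2) ≡ map₁ suc (twoAdic fuel m)
twoAdic-double fuel m@(suc _) =
  trans (twoAdic-even fuel _ (m*n%n≡0 m 2)) (cong (map₁ suc ∘ twoAdic fuel) (m*n/n≡m m 2))

twoAdic-2^s*odd : ∀ s fuel {r} .{{_ : NonZero r}} → r % 2 ≡ 1 → s ≤ fuel →
  twoAdic fuel (2 ^ s * r) ≡ (s , r)
twoAdic-2^s*odd zero fuel {r} r-odd _ =
  trans (cong (twoAdic fuel) (*-identityˡ r)) (twoAdic-odd fuel r r-odd)
twoAdic-2^s*odd (suc s) (suc fuel) {r} r-odd (s≤s s≤fuel) = begin
  twoAdic (suc fuel) (2 * 2 ^ s * r)  ≡⟨ cong (twoAdic (suc fuel)) 2*a*r≡a*r*2 ⟩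
  twoAdic (suc fuel) (2 ^ s * r * 2)  ≡⟨ twoAdic-double fuel (2 ^ s * r) {{m*n≢0 _ r {{m^n≢0 2 s}}}} ⟩
  map₁ suc (twoAdic fuel (2 ^ s * r)) ≡⟨ cong (map₁ suc) (twoAdic-2^s*odd s fuel r-odd s≤fuel) ⟩
  (suc s , r)                         ∎
  where
  2*a*r≡a*r*2 : 2 * 2 ^ s * r ≡ 2 ^ s * r * 2
  2*a*r≡a*r*2 = trans (*-assoc 2 (2 ^ s) r) (*-comm 2 (2 ^ s * r))

P-2^s*odd : ∀ f s {r} .{{_ : NonZero r}} → r % 2 ≡ 1 → P f (2 ^ s * r) ≡ letter (r % 4) (f s)
P-2^s*odd f s {r@(suc _)} r-odd = trans (P≡letter f (2 ^ s * r))
  (cong (λ (s , r) → letter (r % 4) (f s)) (twoAdic-2^s*odd s _ r-odd s≤2^s*r))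
  where
  s≤2^s*r : s ≤ 2 ^ s * r
  s≤2^s*r = ≤-trans (<⇒≤ (n<2^n s)) (m≤m*n (2 ^ s) r)

P-2^s*[r+q*4] : ∀ f s r q .{{_ : NonZero r}} → r % 2 ≡ 1 →
  P f (2 ^ s * (r + q * 4)) ≡ letter (r % 4) (f s)
P-2^s*[r+q*4] f s r@(suc _) q r-odd = begin
  P f (2 ^ s * (r + q * 4))       ≡⟨ P-2^s*odd f s (trans (%-remove-+ʳ r 2∣q*4) r-odd) ⟩
  letter ((r + q * 4) % 4) (f s)  ≡⟨ cong (λ r′ → letter r′ (f s)) (%-remove-+ʳ r {d = 4} (n∣m*n q)) ⟩
  letter (r % 4) (f s)            ∎
  where
  2∣q*4 : 2 ∣ q * 4
  2∣q*4 = ∣n⇒∣m*n q (divides 2 refl)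

P-2^s : ∀ f s → P f (2 ^ s) ≡ f s
P-2^s f s = trans (cong (P f) (sym (*-identityʳ (2 ^ s)))) (P-2^s*[r+q*4] f s 1 0 refl)

P-1*2^s : ∀ f s → P f (1 * 2 ^ s) ≡ f s
P-1*2^s f s = trans (cong (P f) (*-identityˡ (2 ^ s))) (P-2^s f s)

data Residue4 : ℕ → Set where
  rem0 : ∀ q → Residue4 (q * 4)
  rem1 : ∀ q → Residue4 (1 + q * 4)
  rem2 : ∀ q → Residue4 (2 + q * 4)
  rem3 : ∀ q → Residue4 (3 + q * 4)

residue4 : ∀ t → Residue4 t
residue4 zero = rem0 0
residue4 (suc t) with residue4 t
... | rem0 q = rem1 q
... | rem1 q = rem2 q
... | rem2 q = rem3 q
... | rem3 q = rem0 (suc q)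

data OddPartMod4 : ℕ → Set where
  oddPart≡1 : ∀ s q → OddPartMod4 (2 ^ s * (1 + q * 4))
  oddPart≡3 : ∀ s q → OddPartMod4 (2 ^ s * (3 + q * 4))

oddPartMod4-double : ∀ {m} → OddPartMod4 m → OddPartMod4 (2 * m)
oddPartMod4-double (oddPart≡1 s q) = subst OddPartMod4 (*-assoc 2 (2 ^ s) _) (oddPart≡1 (suc s) q)
oddPartMod4-double (oddPart≡3 s q) = subst OddPartMod4 (*-assoc 2 (2 ^ s) _) (oddPart≡3 (suc s) q)

oddPartMod4 : ∀ m → 1 ≤ m → OddPartMod4 m
oddPartMod4 = <-rec (λ m → 1 ≤ m → OddPartMod4 m) go
  where
  go : ∀ m → (∀ {m′} → m′ < m → 1 ≤ m′ → OddPartMod4 m′) → 1 ≤ m → OddPartMod4 m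
  go m rec 1≤m with residue4 m
  ... | rem1 q = subst OddPartMod4 (*-identityˡ _) (oddPart≡1 0 q)
  ... | rem3 q = subst OddPartMod4 (*-identityˡ _) (oddPart≡3 0 q)
  ... | rem0 zero = contradiction 1≤m λ ()
  ... | rem0 (suc q) = subst OddPartMod4 (double≡ q)
        (oddPartMod4-double (rec (s≤s (s≤s (s≤s (m≤n⇒m≤1+n (*-monoʳ-≤ q (s≤s (s≤s z≤n))))))) (s≤s z≤n)))
    where
    double≡ : ∀ q → 2 * (suc q * 2) ≡ suc q * 4
    double≡ = solve-∀
  ... | rem2 q = subst OddPartMod4 (double≡ q)
        (oddPartMod4-double (rec (s≤s (s≤s (*-monoʳ-≤ q (s≤s (s≤s z≤n))))) (s≤s z≤n)))
    where
    double≡ : ∀ q → 2 * (1 + q * 2) ≡ 2 + q * 4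
    double≡ = solve-∀

-- Periodicity off the multiples of 2^k

∤⇒>0 : ∀ {m n} → m ∤ n → 0 < n
∤⇒>0 {m} {zero}  m∤0 = contradiction (m ∣0) m∤0
∤⇒>0 {n = suc _} _   = s≤s z≤n

2^k∤2^s*r⇒s<k : ∀ {k s} r → 2 ^ k ∤ 2 ^ s * r → s < k
2^k∤2^s*r⇒s<k r ∤2^s*r = ≰⇒> (λ k≤s → ∤2^s*r (∣m⇒∣m*n r (^-monoʳ-∣ 2 k≤s)))

2^s*[r+q*4]+x*2^[1+k] : ∀ {s k} r q x → s < k →
  ∃ λ q′ → 2 ^ s * (r + q * 4) + x * 2 ^ suc k ≡ 2 ^ s * (r + q′ * 4)
2^s*[r+q*4]+x*2^[1+k] {s} {k} r q x s<k with ^-monoʳ-∣ 2 (s≤s s<k)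
... | divides B 2^[1+k]≡B*2^[2+s] = q + x * B , (begin
  2 ^ s * (r + q * 4) + x * 2 ^ suc k
    ≡⟨ cong (λ M → 2 ^ s * (r + q * 4) + x * M) 2^[1+k]≡B*2^[2+s] ⟩
  2 ^ s * (r + q * 4) + x * (B * (2 * (2 * 2 ^ s)))
    ≡⟨ regroup (2 ^ s) B r q x ⟩
  2 ^ s * (r + (q + x * B) * 4)
    ∎)
  where
  regroup : ∀ A B r q x → A * (r + q * 4) + x * (B * (2 * (2 * A))) ≡ A * (r + (q + x * B) * 4)
  regroup = solve-∀

P-2^s*[r+q*4]-shift : ∀ f k x s r q .{{_ : NonZero r}} → r % 2 ≡ 1 →
  2 ^ k ∤ 2 ^ s * (r + q * 4) →
  P f (2 ^ s * (r + q * 4) + x * 2 ^ suc k) ≡ P f (2 ^ s * (r + q * 4))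
P-2^s*[r+q*4]-shift f k x s r q r-odd ∤a = begin
  P f (2 ^ s * (r + q * 4) + x * 2 ^ suc k)  ≡⟨ cong (P f) (proj₂ shifted) ⟩
  P f (2 ^ s * (r + proj₁ shifted * 4))      ≡⟨ P-2^s*[r+q*4] f s r (proj₁ shifted) r-odd ⟩
  letter (r % 4) (f s)                       ≡⟨ P-2^s*[r+q*4] f s r q r-odd ⟨
  P f (2 ^ s * (r + q * 4))                  ∎
  where
  shifted : ∃ λ q′ → 2 ^ s * (r + q * 4) + x * 2 ^ suc k ≡ 2 ^ s * (r + q′ * 4)
  shifted = 2^s*[r+q*4]+x*2^[1+k] {s} {k} r q x (2^k∤2^s*r⇒s<k {k} {s} _ ∤a)

P-shift : ∀ f k x {a} → 2 ^ k ∤ a → P f (a + x * 2 ^ suc k) ≡ P f a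
P-shift f k x {a} ∤a with oddPartMod4 a (∤⇒>0 ∤a)
... | oddPart≡1 s q = P-2^s*[r+q*4]-shift f k x s 1 q refl ∤a
... | oddPart≡3 s q = P-2^s*[r+q*4]-shift f k x s 3 q refl ∤a

infix 4 _≡_mod_

_≡_mod_ : ℕ → ℕ → ℕ → Set
a ≡ b mod m = ∃₂ λ x y → a + x * m ≡ b + y * m

m≡m%n-mod : ∀ a m .{{_ : NonZero m}} → a ≡ a % m mod m
m≡m%n-mod a m = 0 , a / m , trans (+-identityʳ a) (m≡m%n+[m/n]*n a m)

+-congʳ-mod : ∀ {a b m} d → a ≡ b mod m → a + d ≡ b + d mod m
+-congʳ-mod {a} {b} {m} d (x , y , eq) = x , y , (begin
  a + d + x * m  ≡⟨ xy∙z≈xz∙y a d (x * m) ⟩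
  a + x * m + d  ≡⟨ cong (_+ d) eq ⟩
  b + y * m + d  ≡⟨ xy∙z≈xz∙y b (y * m) d ⟩
  b + d + y * m  ∎)

+-cancelʳ-mod : ∀ {a b m} d → a + d ≡ b + d mod m → a ≡ b mod m
+-cancelʳ-mod {a} {b} {m} d (x , y , eq) = x , y , +-cancelʳ-≡ d _ _ (begin
  a + x * m + d  ≡⟨ xy∙z≈xz∙y a (x * m) d ⟩
  a + d + x * m  ≡⟨ eq ⟩
  b + d + y * m  ≡⟨ xy∙z≈xz∙y b d (y * m) ⟩
  b + y * m + d  ∎)

P-cong-mod : ∀ f k {a b} → 2 ^ k ∤ a → a ≡ b mod 2 ^ suc k → P f a ≡ P f b
P-cong-mod f k {a} {b} ∤a (x , y , eq) = begin
  P f a                    ≡⟨ P-shift f k x ∤a ⟨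
  P f (a + x * 2 ^ suc k)  ≡⟨ cong (P f) eq ⟩
  P f (b + y * 2 ^ suc k)  ≡⟨ P-shift f k y ∤b ⟩
  P f b                    ∎
  where
  ∣multiple : ∀ z → 2 ^ k ∣ z * 2 ^ suc k
  ∣multiple z = ∣n⇒∣m*n z (n∣m*n 2)
  ∤b : 2 ^ k ∤ b
  ∤b ∣b = ∤a (∣m+n∣m⇒∣n (subst (2 ^ k ∣_) (trans (sym eq) (+-comm a _))
                                (∣m∣n⇒∣m+n ∣b (∣multiple y)))
                         (∣multiple x))

applyUpTo-cong : ∀ {A : Set} {g h : ℕ → A} n → (∀ {d} → d < n → g d ≡ h d) →
  applyUpTo g n ≡ applyUpTo h n
applyUpTo-cong zero    _   = refl
applyUpTo-cong (suc n) g≗h = cong₂ _∷_ (g≗h (s≤s z≤n)) (applyUpTo-cong n (λ d<n → g≗h (s≤s d<n)))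

applyUpTo-cong⁻¹ : ∀ {A : Set} {g h : ℕ → A} n → applyUpTo g n ≡ applyUpTo h n →
  ∀ {d} → d < n → g d ≡ h d
applyUpTo-cong⁻¹ (suc n) eq {zero}  _         = proj₁ (∷-injective eq)
applyUpTo-cong⁻¹ (suc n) eq {suc d} (s≤s d<n) = applyUpTo-cong⁻¹ n (proj₂ (∷-injective eq)) d<n

OccursWithin : FoldSeq → ℕ → ℕ → ℕ → Set
OccursWithin f n K i = ∃[ j ] (1 ≤ j × j + n ∸ 1 ≤ K × factor f j n ≡ factor f i n)

+-∸-monoˡ-≤ : ∀ {j K} n → j ≤ K → j + n ∸ 1 ≤ K + n ∸ 1
+-∸-monoˡ-≤ n j≤K = ∸-monoˡ-≤ 1 (+-monoˡ-≤ n j≤K)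

-- Upper bound

multiple-offset-unique-≤ : ∀ {N i d d′} → d ≤ d′ → d′ < N → N ∣ i + d → N ∣ i + d′ → d ≡ d′
multiple-offset-unique-≤ {N} {i} {d} d≤d′ d′<N N∣i+d N∣i+d′ with m≤n⇒∃[o]m+o≡n d≤d′
... | g , refl = sym (trans (cong (d +_) g≡0) (+-identityʳ d))
  where
  N∣g : N ∣ g
  N∣g = ∣m+n∣m⇒∣n (subst (N ∣_) (sym (+-assoc i d g)) N∣i+d′) N∣i+d
  g≡0 : g ≡ 0
  g≡0 = ∣∧<⇒≡0 N∣g (≤-<-trans (m≤n+m g d) d′<N)

multiple-offset-unique : ∀ {N i d d′} → d < N → d′ < N → N ∣ i + d → N ∣ i + d′ → d ≡ d′
multiple-offset-unique {d = d} {d′} d<N d′<N N∣i+d N∣i+d′ with ≤-total d d′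
... | inj₁ d≤d′ = multiple-offset-unique-≤ d≤d′ d′<N N∣i+d N∣i+d′
... | inj₂ d′≤d = sym (multiple-offset-unique-≤ d′≤d d<N N∣i+d′ N∣i+d)

record Representative (f : FoldSeq) (k c t : ℕ) : Set where
  field
    m           : ℕ
    2^k≤m       : 2 ^ k ≤ m
    m≤c*2^[1+k] : m ≤ c * 2 ^ suc k
    t*2^k≡m     : t * 2 ^ k ≡ m mod 2 ^ suc k
    same-letter : P f m ≡ P f (t * 2 ^ k)

module _ (f : FoldSeq) {k c : ℕ} (2≤c : 2 ≤ c) (flipped : P f (c * 2 ^ suc k) ≡ neg (f (suc k))) where

  private
    2^k≤2^[1+k] : 2 ^ k ≤ 2 ^ suc k
    2^k≤2^[1+k] = m≤m+n (2 ^ k) (2 ^ k + 0)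

    4*2^k≤c*2^[1+k] : 4 * 2 ^ k ≤ c * 2 ^ suc k
    4*2^k≤c*2^[1+k] = ≤-trans (≤-reflexive (*-assoc 2 2 (2 ^ k))) (*-monoˡ-≤ (2 ^ suc k) 2≤c)

    instance
      c≢0 : NonZero c
      c≢0 = >-nonZero (≤-trans (s≤s z≤n) 2≤c)

    even-multiple : ∀ r q N → (r * 2 + q * 4) * N ≡ (r + q * 2) * (2 * N)
    even-multiple = solve-∀

  odd-representative : ∀ r q .{{_ : NonZero r}} → r ≤ 4 →
    P f (2 ^ k * r) ≡ P f (2 ^ k * (r + q * 4)) → Representative f k c (r + q * 4)
  odd-representative r q r≤4 same = record
    { m           = 2 ^ k * r
    ; 2^k≤m       = m≤m*n (2 ^ k) r
    ; m≤c*2^[1+k] = ≤-trans (≤-reflexive (*-comm (2 ^ k) r))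
                            (≤-trans (*-monoˡ-≤ (2 ^ k) r≤4) 4*2^k≤c*2^[1+k])
    ; t*2^k≡m     = 0 , q * 2 , odd-multiple (2 ^ k) r q
    ; same-letter = trans same (cong (P f) (*-comm (2 ^ k) _))
    }
    where
    odd-multiple : ∀ N r q → (r + q * 4) * N + 0 * (2 * N) ≡ N * r + q * 2 * (2 * N)
    odd-multiple = solve-∀

  even-representative : ∀ t y z .{{_ : NonZero z}} → z ≤ c → t * 2 ^ k ≡ y * 2 ^ suc k →
    P f (z * 2 ^ suc k) ≡ P f (t * 2 ^ k) → Representative f k c t
  even-representative t y z z≤c t*2^k≡y*2^[1+k] same = record
    { m           = z * 2 ^ suc k
    ; 2^k≤m       = ≤-trans 2^k≤2^[1+k] (m≤n*m (2 ^ suc k) z)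
    ; m≤c*2^[1+k] = *-monoˡ-≤ (2 ^ suc k) z≤c
    ; t*2^k≡m     = z , y , trans (cong (_+ z * 2 ^ suc k) t*2^k≡y*2^[1+k]) (+-comm (y * 2 ^ suc k) _)
    ; same-letter = same
    }

  even-multiple-representative : ∀ t y → t * 2 ^ k ≡ y * 2 ^ suc k → Representative f k c t
  even-multiple-representative t y t*2^k≡y*2^[1+k] with ≡⊎≡neg (P f (t * 2 ^ k)) (f (suc k))
  ... | inj₁ P≡f  = even-representative t y 1 (≤-trans (s≤s z≤n) 2≤c) t*2^k≡y*2^[1+k]
                      (trans (P-1*2^s f (suc k)) (sym P≡f))
  ... | inj₂ P≡-f = even-representative t y c ≤-refl t*2^k≡y*2^[1+k] (trans flipped (sym P≡-f))

  representative : ∀ t → Representative f k c t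
  representative t with residue4 t
  ... | rem1 q = odd-representative 1 q (s≤s z≤n)
                   (trans (P-2^s*[r+q*4] f k 1 0 refl) (sym (P-2^s*[r+q*4] f k 1 q refl)))
  ... | rem3 q = odd-representative 3 q (s≤s (s≤s (s≤s z≤n)))
                   (trans (P-2^s*[r+q*4] f k 3 0 refl) (sym (P-2^s*[r+q*4] f k 3 q refl)))
  ... | rem0 q = even-multiple-representative (q * 4) (q * 2) (even-multiple 0 q (2 ^ k))
  ... | rem2 q = even-multiple-representative (2 + q * 4) (1 + q * 2) (even-multiple 1 q (2 ^ k))

module _ (f : FoldSeq) {n k c : ℕ} (1≤n : 1 ≤ n) (n≤2^k : n ≤ 2 ^ k) (2≤c : 2 ≤ c)
         (flipped : P f (c * 2 ^ suc k) ≡ neg (f (suc k))) where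

  private
    instance
      2^[1+k]≢0 : NonZero (2 ^ suc k)
      2^[1+k]≢0 = m^n≢0 2 (suc k)

    2^[1+k]≤c*2^[1+k] : 2 ^ suc k ≤ c * 2 ^ suc k
    2^[1+k]≤c*2^[1+k] = m≤n*m (2 ^ suc k) c {{>-nonZero (≤-trans (s≤s z≤n) 2≤c)}}

  window-without-multiple : ∀ i → (∀ {d} → d < n → 2 ^ k ∤ i + d) →
    OccursWithin f n (c * 2 ^ suc k + n ∸ 1) i
  window-without-multiple i ∤window =
    i % 2 ^ suc k , 1≤i%2^[1+k] ,
    +-∸-monoˡ-≤ n (≤-trans (m%n≤n i _) 2^[1+k]≤c*2^[1+k]) ,
    applyUpTo-cong n (λ {d} d<n → sym (P-cong-mod f k (∤window d<n) (+-congʳ-mod d (m≡m%n-mod i _))))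
    where
    1≤i%2^[1+k] : 1 ≤ i % 2 ^ suc k
    1≤i%2^[1+k] = ∤⇒>0 λ ∣i%2^[1+k] →
      ∤window 1≤n (subst (2 ^ k ∣_) (sym (+-identityʳ i)) (∣n∣m%n⇒∣m (n∣m*n 2) ∣i%2^[1+k]))

  window-with-multiple : ∀ i d₀ t → d₀ < n → i + d₀ ≡ t * 2 ^ k →
    OccursWithin f n (c * 2 ^ suc k + n ∸ 1) i
  window-with-multiple i d₀ t d₀<n i+d₀≡t*2^k =
    j , m<n⇒0<n∸m d₀<m , +-∸-monoˡ-≤ n (≤-trans (m∸n≤m m d₀) m≤c*2^[1+k]) , applyUpTo-cong n same
    where
    open Representative (representative f 2≤c flipped t)
    j : ℕ
    j = m ∸ d₀
    d₀<m : d₀ < m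
    d₀<m = ≤-trans d₀<n (≤-trans n≤2^k 2^k≤m)
    i≡j : i ≡ j mod 2 ^ suc k
    i≡j = +-cancelʳ-mod d₀ (subst₂ (λ a b → a ≡ b mod 2 ^ suc k)
                                   (sym i+d₀≡t*2^k) (sym (m∸n+n≡m (<⇒≤ d₀<m))) t*2^k≡m)
    same : ∀ {d} → d < n → P f (j + d) ≡ P f (i + d)
    same {d} d<n with 2 ^ k ∣? i + d
    ... | no ∤i+d = sym (P-cong-mod f k ∤i+d (+-congʳ-mod d i≡j))
    ... | yes ∣i+d
        with multiple-offset-unique (≤-trans d<n n≤2^k) (≤-trans d₀<n n≤2^k) ∣i+d (divides t i+d₀≡t*2^k)
    ...   | refl = begin
      P f (j + d)      ≡⟨ cong (P f) (m∸n+n≡m (<⇒≤ d₀<m)) ⟩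
      P f m            ≡⟨ same-letter ⟩
      P f (t * 2 ^ k)  ≡⟨ cong (P f) i+d₀≡t*2^k ⟨
      P f (i + d)      ∎

  all-factors-in : AllFactorsIn f n (c * 2 ^ suc k + n ∸ 1)
  all-factors-in i _ with anyUpTo? (λ d → 2 ^ k ∣? i + d) n
  ... | yes (d₀ , d₀<n , divides t i+d₀≡t*2^k) = window-with-multiple i d₀ t d₀<n i+d₀≡t*2^k
  ... | no ∄ = window-without-multiple i (λ d<n ∣i+d → ∄ (_ , d<n , ∣i+d))

-- Lower bound

record FlipsFirstAt (f : FoldSeq) (k c : ℕ) : Set where
  field
    unflipped : ∀ u → 1 ≤ u → u < c → P f (u * 2 ^ suc k) ≡ f (suc k)
    flipped   : P f (c * 2 ^ suc k) ≡ neg (f (suc k))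

P[8Q+2]≢P[8Q+6] : ∀ f Q → P f (Q * 8 + 2) ≢ P f (Q * 8 + 6)
P[8Q+2]≢P[8Q+6] f Q eq = neg-≢ (f 1) (begin
  neg (f 1)                  ≡⟨ P-2^s*[r+q*4] f 1 3 Q refl ⟨
  P f (2 ^ 1 * (3 + Q * 4))  ≡⟨ cong (P f) (8Q+6≡ Q) ⟨
  P f (Q * 8 + 6)            ≡⟨ eq ⟨
  P f (Q * 8 + 2)            ≡⟨ cong (P f) (8Q+2≡ Q) ⟩
  P f (2 ^ 1 * (1 + Q * 4))  ≡⟨ P-2^s*[r+q*4] f 1 1 Q refl ⟩
  f 1                        ∎)
  where
  8Q+2≡ : ∀ Q → Q * 8 + 2 ≡ 2 ^ 1 * (1 + Q * 4)
  8Q+2≡ = solve-∀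
  8Q+6≡ : ∀ Q → Q * 8 + 6 ≡ 2 ^ 1 * (3 + Q * 4)
  8Q+6≡ = solve-∀

P[odd+2]≡P[odd+6] : ∀ f r q → r % 2 ≡ 1 →
  P f (2 ^ 0 * (r + q * 4) + 2) ≡ P f (2 ^ 0 * (r + q * 4) + 6)
P[odd+2]≡P[odd+6] f r q r-odd = begin
  P f (2 ^ 0 * (r + q * 4) + 2)        ≡⟨ cong (P f) (+2≡ r q) ⟩
  P f (2 ^ 0 * (2 + r + q * 4))        ≡⟨ P-2^s*[r+q*4] f 0 (2 + r) q 2+r-odd ⟩
  letter ((2 + r) % 4) (f 0)           ≡⟨ P-2^s*[r+q*4] f 0 (2 + r) (1 + q) 2+r-odd ⟨
  P f (2 ^ 0 * (2 + r + (1 + q) * 4))  ≡⟨ cong (P f) (+6≡ r q) ⟨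
  P f (2 ^ 0 * (r + q * 4) + 6)        ∎
  where
  2+r-odd : (2 + r) % 2 ≡ 1
  2+r-odd = trans (%-remove-+ˡ r {d = 2} ∣-refl) r-odd
  +2≡ : ∀ r q → 2 ^ 0 * (r + q * 4) + 2 ≡ 2 ^ 0 * (2 + r + q * 4)
  +2≡ = solve-∀
  +6≡ : ∀ r q → 2 ^ 0 * (r + q * 4) + 6 ≡ 2 ^ 0 * (2 + r + (1 + q) * 4)
  +6≡ = solve-∀

P[2^[1+t]*[r+q*4]+2^t] : ∀ f t r q →
  P f (2 ^ suc t * (r + q * 4) + 2 ^ t) ≡ letter ((1 + r * 2) % 4) (f t)
P[2^[1+t]*[r+q*4]+2^t] f t r q =
  trans (cong (P f) (regroup (2 ^ t) r q))
        (P-2^s*[r+q*4] f t (1 + r * 2) (q * 2) ([m+kn]%n≡m%n 1 r 2))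
  where
  regroup : ∀ A r q → 2 * A * (r + q * 4) + A ≡ A * (1 + r * 2 + q * 2 * 4)
  regroup = solve-∀

P[c*2^[1+k]+2^t] : ∀ f {k t} c → t < k → P f (c * 2 ^ suc k + 2 ^ t) ≡ f t
P[c*2^[1+k]+2^t] f {k} {t} c t<k = begin
  P f (c * 2 ^ suc k + 2 ^ t)  ≡⟨ cong (P f) (+-comm (c * 2 ^ suc k) (2 ^ t)) ⟩
  P f (2 ^ t + c * 2 ^ suc k)  ≡⟨ P-shift f k c (>⇒∤ {{m^n≢0 2 t}} (^-monoʳ-< 2 (s≤s (s≤s z≤n)) t<k)) ⟩
  P f (2 ^ t)                  ≡⟨ P-2^s f t ⟩
  f t                          ∎

module _ (f : FoldSeq) {n k c : ℕ} (7≤n : 7 ≤ n) (2≤k : 2 ≤ k) (2^[k∸1]<n : 2 ^ (k ∸ 1) < n)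
         (flips : FlipsFirstAt f k c) where

  open FlipsFirstAt flips

  AgreesWithFlip : ℕ → Set
  AgreesWithFlip j = ∀ {d} → d < n → P f (j + d) ≡ P f (c * 2 ^ suc k + d)

  P[j+2]≢P[j+6] : ∀ j → AgreesWithFlip j → P f (j + 2) ≢ P f (j + 6)
  P[j+2]≢P[j+6] j agrees eq with ∣n⇒∣m*n c (^-monoʳ-∣ 2 (s≤s 2≤k))
  ... | divides Q c*2^[1+k]≡Q*8 =
    P[8Q+2]≢P[8Q+6] f Q (subst (λ i → P f (i + 2) ≡ P f (i + 6)) c*2^[1+k]≡Q*8 (begin
      P f (c * 2 ^ suc k + 2)  ≡⟨ agrees (≤-trans (s≤s (s≤s (s≤s z≤n))) 7≤n) ⟨
      P f (j + 2)              ≡⟨ eq ⟩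
      P f (j + 6)              ≡⟨ agrees 7≤n ⟩
      P f (c * 2 ^ suc k + 6)  ∎))

  P[j+2^t]≢-f[t] : ∀ j {t} → AgreesWithFlip j → t < k → P f (j + 2 ^ t) ≢ neg (f t)
  P[j+2^t]≢-f[t] j {t} agrees t<k eq = neg-≢ (f t) (begin
    neg (f t)                    ≡⟨ eq ⟨
    P f (j + 2 ^ t)              ≡⟨ agrees (≤-<-trans (^-monoʳ-≤ 2 (∸-monoˡ-≤ 1 t<k)) 2^[k∸1]<n) ⟩
    P f (c * 2 ^ suc k + 2 ^ t)  ≡⟨ P[c*2^[1+k]+2^t] f c t<k ⟩
    f t                          ∎)

  ¬AgreesWithFlip[u*2^[1+k]] : ∀ {u} → 1 ≤ u → u < c → ¬ AgreesWithFlip (u * 2 ^ suc k)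
  ¬AgreesWithFlip[u*2^[1+k]] {u} 1≤u u<c agrees = neg-≢ (f (suc k)) (begin
    neg (f (suc k))          ≡⟨ flipped ⟨
    P f (c * 2 ^ suc k)      ≡⟨ cong (P f) (+-identityʳ (c * 2 ^ suc k)) ⟨
    P f (c * 2 ^ suc k + 0)  ≡⟨ agrees (≤-trans (s≤s z≤n) 7≤n) ⟨
    P f (u * 2 ^ suc k + 0)  ≡⟨ cong (P f) (+-identityʳ (u * 2 ^ suc k)) ⟩
    P f (u * 2 ^ suc k)      ≡⟨ unflipped u 1≤u u<c ⟩
    f (suc k)                ∎)

  ¬AgreesWithFlip-earlier : ∀ {j} → 1 ≤ j → j < c * 2 ^ suc k → ¬ AgreesWithFlip j
  ¬AgreesWithFlip-earlier {j} 1≤j j<c*2^[1+k] agrees with 2 ^ suc k ∣? j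
  ... | yes (divides zero    refl) = contradiction 1≤j λ ()
  ... | yes (divides (suc u) refl) =
    ¬AgreesWithFlip[u*2^[1+k]] (s≤s z≤n) (*-cancelʳ-< (2 ^ suc k) (suc u) c j<c*2^[1+k]) agrees
  ... | no ∤j with oddPartMod4 j 1≤j
  ...   | oddPart≡1 zero q =
    P[j+2]≢P[j+6] (2 ^ 0 * (1 + q * 4)) agrees (P[odd+2]≡P[odd+6] f 1 q refl)
  ...   | oddPart≡3 zero q =
    P[j+2]≢P[j+6] (2 ^ 0 * (3 + q * 4)) agrees (P[odd+2]≡P[odd+6] f 3 q refl)
  ...   | oddPart≡1 (suc t) q =
    P[j+2^t]≢-f[t] (2 ^ suc t * (1 + q * 4)) agrees (≤-pred (2^k∤2^s*r⇒s<k _ ∤j))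
                   (P[2^[1+t]*[r+q*4]+2^t] f t 1 q)
  ...   | oddPart≡3 (suc t) q =
    P[j+2^t]≢-f[t] (2 ^ suc t * (3 + q * 4)) agrees (≤-pred (2^k∤2^s*r⇒s<k _ ∤j))
                   (P[2^[1+t]*[r+q*4]+2^t] f t 3 q)

  appearance-lower-bound : 1 ≤ c → ∀ K → AllFactorsIn f n K → c * 2 ^ suc k + n ∸ 1 ≤ K
  appearance-lower-bound 1≤c K all-in-K with all-in-K (c * 2 ^ suc k) (*-mono-≤ 1≤c (m^n>0 2 (suc k)))
  ... | j , 1≤j , j+n∸1≤K , same with c * 2 ^ suc k ≤? j
  ...   | yes c*2^[1+k]≤j = ≤-trans (+-∸-monoˡ-≤ n c*2^[1+k]≤j) j+n∸1≤K
  ...   | no  c*2^[1+k]≰j =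
    ⊥-elim (¬AgreesWithFlip-earlier 1≤j (≰⇒> c*2^[1+k]≰j) (applyUpTo-cong⁻¹ n same))

4≤2^k⇒2≤k : ∀ {k} → 4 ≤ 2 ^ k → 2 ≤ k
4≤2^k⇒2≤k {zero}        (s≤s ())
4≤2^k⇒2≤k {suc zero}    (s≤s (s≤s ()))
4≤2^k⇒2≤k {suc (suc k)} _ = s≤s (s≤s z≤n)

appearance : ∀ f {n k c} → 7 ≤ n → 2 ^ (k ∸ 1) < n → n ≤ 2 ^ k → 2 ≤ c → FlipsFirstAt f k c →
  AppearanceIs f n (c * 2 ^ suc k + n ∸ 1)
appearance f {k = k} 7≤n 2^[k∸1]<n n≤2^k 2≤c flips =
  all-factors-in f (≤-trans (s≤s z≤n) 7≤n) n≤2^k 2≤c (FlipsFirstAt.flipped flips) ,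
  appearance-lower-bound f 7≤n 2≤k 2^[k∸1]<n flips (≤-trans (s≤s z≤n) 2≤c)
  where
  2≤k : 2 ≤ k
  2≤k = 4≤2^k⇒2≤k (≤-trans (s≤s (s≤s (s≤s (s≤s z≤n)))) (≤-trans 7≤n n≤2^k))

flipsFirstAt-2 : ∀ f k → f (suc k) ≢ f (suc (suc k)) → FlipsFirstAt f k 2
flipsFirstAt-2 f k f[1+k]≢f[2+k] = record
  { unflipped = λ { zero () _ ; (suc zero) _ _ → P-1*2^s f (suc k) ; (suc (suc _)) _ (s≤s (s≤s ())) }
  ; flipped   = trans (P-2^s f (suc (suc k))) (≢⇒≡neg f[1+k]≢f[2+k])
  }

flipsFirstAt-3 : ∀ f k → f (suc k) ≡ f (suc (suc k)) → FlipsFirstAt f k 3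
flipsFirstAt-3 f k f[1+k]≡f[2+k] = record
  { unflipped = λ { zero () _
                  ; (suc zero) _ _ → P-1*2^s f (suc k)
                  ; (suc (suc zero)) _ _ → trans (P-2^s f (suc (suc k))) (sym f[1+k]≡f[2+k])
                  ; (suc (suc (suc _))) _ (s≤s (s≤s (s≤s ()))) }
  ; flipped   = trans (cong (P f) (*-comm 3 (2 ^ suc k))) (P-2^s*[r+q*4] f (suc k) 3 0 refl)
  }

corollary3p5 : (f : FoldSeq) (n k : ℕ) → 7 ≤ n → 2 ^ (k ∸ 1) < n → n ≤ 2 ^ k →
    (f (suc k) ≢ f (suc (suc k)) → AppearanceIs f n (4 * 2 ^ k + n ∸ 1))
    × (f (suc k) ≡ f (suc (suc k)) → AppearanceIs f n (6 * 2 ^ k + n ∸ 1))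
corollary3p5 f n k 7≤n 2^[k∸1]<n n≤2^k =
  (λ f[1+k]≢f[2+k] → subst (λ K → AppearanceIs f n (K + n ∸ 1)) (sym (*-assoc 2 2 (2 ^ k)))
     (appearance f 7≤n 2^[k∸1]<n n≤2^k (s≤s (s≤s z≤n)) (flipsFirstAt-2 f k f[1+k]≢f[2+k]))) ,
  (λ f[1+k]≡f[2+k] → subst (λ K → AppearanceIs f n (K + n ∸ 1)) (sym (*-assoc 3 2 (2 ^ k)))
     (appearance f 7≤n 2^[k∸1]<n n≤2^k (s≤s (s≤s z≤n)) (flipsFirstAt-3 f k f[1+k]≡f[2+k])))
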